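{- For every integer $m \geq 1$ and every even divisor $n$ of $2(m^2+m+1)$ with $n \geq 4m+2$, the Nest graph $\mathcal{N}(n;1,2m+1,2m+2;1)$ is arc-transitive and each of its edges lies on exactly two $3$-cycles.
   Context: For integers $n \geq 4$ and $1 \leq a,b,c,k \leq n-1$ with $k \neq n/2$ and $a,b,c$ pairwise distinct, the Nest graph $\mathcal{N}(n;a,b,c;k)$ is the graph with vertex set $\{u_i : i \in \mathbb{Z}_n\} \cup \{v_i : i \in \mathbb{Z}_n\}$ and edges $u_iu_{i+1}$, $v_iv_{i+k}$, $u_iv_i$, $u_iv_{i+a}$, $u_iv_{i+b}$, $u_iv_{i+c}$ for $i \in \mathbb{Z}_n$ (indices modulo $n$). Arc-transitive means the automorphism group acts transitively on arcs. -}

module Defs where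

open import Data.Nat using (ℕ; zero; suc; _+_)
open import Data.Nat.DivMod using (_mod_)
open import Data.Fin using (Fin; toℕ)
open import Data.Product using (_×_; _,_; Σ; ∃; ∃-syntax)
open import Data.Sum using (_⊎_)
open import Data.Empty using (⊥)
open import Relation.Nullary using (¬_)
open import Relation.Binary.PropositionalEquality using (_≡_)
open import Function.Bundles using (_↔_; Inverse; _⇔_)

data Side : Set where
  U V : Side

-- vertices of a Nest graph on Z_n: (U , i) is u_i, (V , i) is v_i
Vertex : ℕ → Set
Vertex n = Side × Fin n

shift : ∀ {n} → Fin n → ℕ → Fin n
shift {suc n} i d = (toℕ i + d) mod (suc n)

-- directed generating edges of N(n;a,b,c;k):
--   u_i u_{i+1},  v_i v_{i+k},  u_i v_i,  u_i v_{i+a},  u_i v_{i+b},  u_i v_{i+c}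
data NestEdge (n a b c k : ℕ) : Vertex n → Vertex n → Set where
  uu  : ∀ i → NestEdge n a b c k (U , i) (U , shift i 1)
  vv  : ∀ i → NestEdge n a b c k (V , i) (V , shift i k)
  uv0 : ∀ i → NestEdge n a b c k (U , i) (V , i)
  uva : ∀ i → NestEdge n a b c k (U , i) (V , shift i a)
  uvb : ∀ i → NestEdge n a b c k (U , i) (V , shift i b)
  uvc : ∀ i → NestEdge n a b c k (U , i) (V , shift i c)

NestAdj : (n a b c k : ℕ) → Vertex n → Vertex n → Set
NestAdj n a b c k x y = NestEdge n a b c k x y ⊎ NestEdge n a b c k y x

record Automorphism {W : Set} (Adj : W → W → Set) : Set where
  field
    bij      : W ↔ W
    preserve : ∀ x y → Adj x y ⇔ Adj (Inverse.to bij x) (Inverse.to bij y)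

ArcTransitive : {W : Set} → (W → W → Set) → Set
ArcTransitive {W} Adj =
  ∀ (x y x′ y′ : W) → Adj x y → Adj x′ y′ →
  Σ (Automorphism Adj) λ φ →
    (Inverse.to (Automorphism.bij φ) x ≡ x′) × (Inverse.to (Automorphism.bij φ) y ≡ y′)

ClosesTriangle : {W : Set} → (W → W → Set) → W → W → W → Set
ClosesTriangle Adj x y z = Adj x z × Adj y z

EveryEdgeOnExactlyTwoTriangles : {W : Set} → (W → W → Set) → Set
EveryEdgeOnExactlyTwoTriangles {W} Adj =
  ∀ (x y : W) → Adj x y →
  ∃[ z₁ ] ∃[ z₂ ] (¬ z₁ ≡ z₂ × ClosesTriangle Adj x y z₁ × ClosesTriangle Adj x y z₂
     × (∀ z → ClosesTriangle Adj x y z → z ≡ z₁ ⊎ z ≡ z₂))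

-- Sending u_i to (i , 0) and v_i to (i , 1) turns the six kinds of edges of
-- N(n;1,2m+1,2m+2;1) into the six unit vectors ±(1,0), ±(1,1), ±(0,1) of the triangular
-- lattice ℤ², so the graph is the quotient of the triangular lattice graph by the
-- sublattice L spanned by (2m+2 , 2) and (n , 0), of index 2n. The divisibility conditions
-- on n make L invariant under the rotation by 60°, so rotations and
-- translations descend to automorphisms, and these act transitively on arcs. Hence it
-- suffices to count triangles at one edge: a common neighbour of x and x + e gives a sum of
-- three unit vectors lying in L, and since L ⊆ 2ℤ² and (2 , 0) ∉ L (as n > 2) that sum is 0,
-- which leaves exactly the two triangles of the triangular lattice.

module Submission where

open import Defs
open import Data.Nat as ℕ using (ℕ; zero; suc; NonZero; s≤s; z≤n)
import Data.Nat.Properties as ℕP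
open import Data.Nat.DivMod using (m<n⇒m%n≡m; m≡m%n+[m/n]*n; _%_; _/_)
open import Data.Nat.Divisibility using (_∣_; quotient; m∣n⇒n≡quotient*m)
open import Data.Fin using (Fin; toℕ; fromℕ<)
open import Data.Fin.Properties using (toℕ-fromℕ<; fromℕ<-cong; toℕ-injective; toℕ<n)
open import Data.Integer using (ℤ; +_; -[1+_]; ∣_∣; _%ℕ_; _/ℕ_)
open import Data.Integer.Properties
  using (abs-*; ∣i∣≡0⇒i≡0; m-n≡m⊖n; ∣m⊝n∣≤m⊔n; i-j≡0⇒i≡j; i≡j⇒i-j≡0; +-injective;
         pos-+; pos-*; +-identityˡ; +-identityʳ; *-cancelʳ-≡; neg-involutive)
open import Data.Integer.DivMod using (a≡a%ℕn+[a/ℕn]*n; n%ℕd<d)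
open import Data.Integer.Tactic.RingSolver using (solve-∀)
open import Data.Product using (_×_; _,_; Σ; ∃-syntax; ∃₂; proj₁; proj₂)
open import Data.Sum using (_⊎_; inj₁; inj₂) renaming (map to ⊎-map)
open import Data.Empty using (⊥-elim)
open import Function.Base using (_∘_)
open import Function.Bundles using (Inverse; Equivalence; mk↔ₛ′; mk⇔)
open import Relation.Nullary using (¬_)
open import Relation.Binary.Bundles using (Setoid)
open import Relation.Binary.PropositionalEquality
import Relation.Binary.Reasoning.Setoid as SetoidReasoning

module _ {W : Set} (Adj : W → W → Set) where

  OnExactlyTwoTriangles : W → W → Set
  OnExactlyTwoTriangles x y =
    ∃[ z₁ ] ∃[ z₂ ] (¬ z₁ ≡ z₂ × ClosesTriangle Adj x y z₁ × ClosesTriangle Adj x y z₂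
      × (∀ z → ClosesTriangle Adj x y z → z ≡ z₁ ⊎ z ≡ z₂))

  automorphism-preserves-triangles : (φ : Automorphism Adj) → ∀ {x y} →
    let open Inverse (Automorphism.bij φ) in
    OnExactlyTwoTriangles x y → OnExactlyTwoTriangles (to x) (to y)
  automorphism-preserves-triangles φ {x} {y} (z₁ , z₂ , z₁≢z₂ , (x~z₁ , y~z₁) , (x~z₂ , y~z₂) , only) =
    to z₁ , to z₂ , (λ eq → z₁≢z₂ (to-injective eq)) ,
    (forward x z₁ x~z₁ , forward y z₁ y~z₁) , (forward x z₂ x~z₂ , forward y z₂ y~z₂) ,
    λ z (x′~z , y′~z) → ⊎-map (back z) (back z) (only (from z) (backward x z x′~z , backward y z y′~z))
    where
    open Inverse (Automorphism.bij φ)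
    forward : ∀ u v → Adj u v → Adj (to u) (to v)
    forward u v = Equivalence.to (Automorphism.preserve φ u v)
    backward : ∀ u v → Adj (to u) v → Adj u (from v)
    backward u v a = Equivalence.from (Automorphism.preserve φ u (from v))
      (subst (Adj (to u)) (sym (strictlyInverseˡ v)) a)
    to-injective : ∀ {u v} → to u ≡ to v → u ≡ v
    to-injective {u} {v} eq = trans (sym (strictlyInverseʳ u)) (trans (cong from eq) (strictlyInverseʳ v))
    back : ∀ z {w} → from z ≡ w → z ≡ to w
    back z eq = trans (sym (strictlyInverseˡ z)) (cong to eq)

  arc-transitive-triangles : ArcTransitive Adj → ∀ {x₀ y₀} → Adj x₀ y₀ →
    OnExactlyTwoTriangles x₀ y₀ → EveryEdgeOnExactlyTwoTriangles Adj
  arc-transitive-triangles arc-transitive {x₀} {y₀} x₀~y₀ triangles x y x~y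
    with arc-transitive x₀ y₀ x y x₀~y₀ x~y
  ... | φ , refl , refl = automorphism-preserves-triangles φ triangles

module TriangularLattice where

  open import Data.Integer using (_+_; _*_; _-_; -_)

  multiple-of-<-is-zero : ∀ d {k x} → x ≡ k * + d → ∣ x ∣ ℕ.< d → x ≡ + 0
  multiple-of-<-is-zero d {k} {x} x≡kd ∣x∣<d =
    ∣i∣≡0⇒i≡0 (absurd-unless-zero ∣ k ∣ (trans (cong ∣_∣ x≡kd) (abs-* k (+ d))))
    where
    absurd-unless-zero : ∀ j → ∣ x ∣ ≡ j ℕ.* d → ∣ x ∣ ≡ 0
    absurd-unless-zero zero    eq = eq
    absurd-unless-zero (suc j) eq =
      ⊥-elim (ℕP.<⇒≱ ∣x∣<d (subst (d ℕ.≤_) (sym eq) (ℕP.m≤m+n d (j ℕ.* d))))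

  %ℕ-cong : ∀ d .{{_ : NonZero d}} {x} y k → x ≡ y + k * + d → x %ℕ d ≡ y %ℕ d
  %ℕ-cong d {x} y k x≡y+kd = +-injective (i-j≡0⇒i≡j _ _
    (multiple-of-<-is-zero d {k + qy - qx} remainders-differ-by-multiple ∣rx-ry∣<d))
    where
    open ≡-Reasoning
    D = + d
    rx = x %ℕ d
    ry = y %ℕ d
    qx = x /ℕ d
    qy = y /ℕ d
    regroup : ∀ rx ry qx qy D → rx - ry ≡ (rx + qx * D) - (ry + qy * D) + (qy - qx) * D
    regroup = solve-∀
    collect : ∀ y k qx qy D → (y + k * D) - y + (qy - qx) * D ≡ (k + qy - qx) * D
    collect = solve-∀
    remainders-differ-by-multiple : + rx - + ry ≡ (k + qy - qx) * D
    remainders-differ-by-multiple = begin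
      + rx - + ry                                        ≡⟨ regroup (+ rx) (+ ry) qx qy D ⟩
      (+ rx + qx * D) - (+ ry + qy * D) + (qy - qx) * D
        ≡⟨ cong₂ (λ u v → u - v + (qy - qx) * D) (sym (a≡a%ℕn+[a/ℕn]*n x d)) (sym (a≡a%ℕn+[a/ℕn]*n y d)) ⟩
      x - y + (qy - qx) * D                              ≡⟨ cong (λ u → u - y + (qy - qx) * D) x≡y+kd ⟩
      (y + k * D) - y + (qy - qx) * D                    ≡⟨ collect y k qx qy D ⟩
      (k + qy - qx) * D                                  ∎
    ∣rx-ry∣<d : ∣ + rx - + ry ∣ ℕ.< d
    ∣rx-ry∣<d = subst (λ z → ∣ z ∣ ℕ.< d) (sym (m-n≡m⊖n rx ry))
      (ℕP.≤-<-trans (∣m⊝n∣≤m⊔n rx ry) (ℕP.⊔-pres-<m (n%ℕd<d x d) (n%ℕd<d y d)))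

  Vec2 : Set
  Vec2 = ℤ × ℤ

  𝟎 : Vec2
  𝟎 = + 0 , + 0

  infixl 6 _⊕_
  _⊕_ : Vec2 → Vec2 → Vec2
  (a , b) ⊕ (a′ , b′) = a + a′ , b + b′

  ⊖_ : Vec2 → Vec2
  ⊖ (a , b) = - a , - b

  ⊖-involutive : ∀ p → ⊖ ⊖ p ≡ p
  ⊖-involutive (a , b) = cong₂ _,_ (neg-involutive a) (neg-involutive b)

  ⊕-assoc : ∀ p q r → p ⊕ q ⊕ r ≡ p ⊕ (q ⊕ r)
  ⊕-assoc (a , b) (a′ , b′) (a″ , b″) = cong₂ _,_ (assoc a a′ a″) (assoc b b′ b″)
    where
    assoc : ∀ x y z → x + y + z ≡ x + (y + z)
    assoc = solve-∀

  -- ρ (a , b) = (a - b , a) is the rotation by 60° of the triangular lattice ℤ² whose basis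
  -- vectors (1 , 0) and (0 , 1) enclose 120°; its six unit vectors are the ρ-orbit of (1 , 0).
  ρ : Vec2 → Vec2
  ρ (a , b) = a - b , a

  ρ^ : ℕ → Vec2 → Vec2
  ρ^ zero    p = p
  ρ^ (suc j) p = ρ (ρ^ j p)

  ρ-⊕ : ∀ p q → ρ (p ⊕ q) ≡ ρ p ⊕ ρ q
  ρ-⊕ (a , b) (a′ , b′) = cong (_, a + a′) (linear a b a′ b′)
    where
    linear : ∀ a b a′ b′ → (a + a′) - (b + b′) ≡ (a - b) + (a′ - b′)
    linear = solve-∀

  ρ-⊖ : ∀ p → ρ (⊖ p) ≡ ⊖ ρ p
  ρ-⊖ (a , b) = cong (_, - a) (linear a b)
    where
    linear : ∀ a b → - a - - b ≡ - (a - b)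
    linear = solve-∀

  ρ^-⊕ : ∀ j p q → ρ^ j (p ⊕ q) ≡ ρ^ j p ⊕ ρ^ j q
  ρ^-⊕ zero    p q = refl
  ρ^-⊕ (suc j) p q = trans (cong ρ (ρ^-⊕ j p q)) (ρ-⊕ (ρ^ j p) (ρ^ j q))

  ρ^-⊖ : ∀ j p → ρ^ j (⊖ p) ≡ ⊖ ρ^ j p
  ρ^-⊖ zero    p = refl
  ρ^-⊖ (suc j) p = trans (cong ρ (ρ^-⊖ j p)) (ρ-⊖ (ρ^ j p))

  ρ^-+ : ∀ i j p → ρ^ (i ℕ.+ j) p ≡ ρ^ i (ρ^ j p)
  ρ^-+ zero    j p = refl
  ρ^-+ (suc i) j p = cong ρ (ρ^-+ i j p)

  ρ³≡⊖ : ∀ p → ρ^ 3 p ≡ ⊖ p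
  ρ³≡⊖ (a , b) = cong₂ _,_ (first a b) (second a b)
    where
    first : ∀ a b → ((a - b) - a) - (a - b) ≡ - a
    first = solve-∀
    second : ∀ a b → (a - b) - a ≡ - b
    second = solve-∀

  ρ^6≡id : ∀ p → ρ^ 6 p ≡ p
  ρ^6≡id p = begin
    ρ^ 3 (ρ^ 3 p)   ≡⟨ ρ³≡⊖ (ρ^ 3 p) ⟩
    ⊖ ρ^ 3 p        ≡⟨ cong ⊖_ (ρ³≡⊖ p) ⟩
    ⊖ ⊖ p           ≡⟨ ⊖-involutive p ⟩
    p               ∎
    where open ≡-Reasoning

  ρ^-multiple-of-6 : ∀ j p → ρ^ (j ℕ.* 6) p ≡ p
  ρ^-multiple-of-6 zero    p = refl
  ρ^-multiple-of-6 (suc j) p =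
    trans (ρ^-+ 6 (j ℕ.* 6) p) (trans (cong (ρ^ 6) (ρ^-multiple-of-6 j p)) (ρ^6≡id p))

  ρ^-inverseˡ : ∀ j p → ρ^ (j ℕ.* 5) (ρ^ j p) ≡ p
  ρ^-inverseˡ j p = begin
    ρ^ (j ℕ.* 5) (ρ^ j p) ≡⟨ ρ^-+ (j ℕ.* 5) j p ⟨
    ρ^ (j ℕ.* 5 ℕ.+ j) p  ≡⟨ cong (λ i → ρ^ i p) (five-plus-one j) ⟩
    ρ^ (j ℕ.* 6) p        ≡⟨ ρ^-multiple-of-6 j p ⟩
    p                     ∎
    where
    open ≡-Reasoning
    five-plus-one : ∀ j → j ℕ.* 5 ℕ.+ j ≡ j ℕ.* 6
    five-plus-one j = trans (ℕP.+-comm (j ℕ.* 5) j) (sym (ℕP.*-suc j 5))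

  ρ^-inverseʳ : ∀ j p → ρ^ j (ρ^ (j ℕ.* 5) p) ≡ p
  ρ^-inverseʳ j p = begin
    ρ^ j (ρ^ (j ℕ.* 5) p) ≡⟨ ρ^-+ j (j ℕ.* 5) p ⟨
    ρ^ (j ℕ.+ j ℕ.* 5) p  ≡⟨ cong (λ i → ρ^ i p) (ℕP.+-comm j (j ℕ.* 5)) ⟩
    ρ^ (j ℕ.* 5 ℕ.+ j) p  ≡⟨ ρ^-+ (j ℕ.* 5) j p ⟩
    ρ^ (j ℕ.* 5) (ρ^ j p) ≡⟨ ρ^-inverseˡ j p ⟩
    p                     ∎
    where open ≡-Reasoning

  data Direction : Set where
    d₀ d₁ d₂ d₃ d₄ d₅ : Direction

  unit : Direction → Vec2
  unit d₀ = + 1 , + 0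
  unit d₁ = + 1 , + 1
  unit d₂ = + 0 , + 1
  unit d₃ = -[1+ 0 ] , + 0
  unit d₄ = -[1+ 0 ] , -[1+ 0 ]
  unit d₅ = + 0 , -[1+ 0 ]

  turn : Direction → Direction
  turn d₀ = d₁
  turn d₁ = d₂
  turn d₂ = d₃
  turn d₃ = d₄
  turn d₄ = d₅
  turn d₅ = d₀

  turn^ : ℕ → Direction → Direction
  turn^ zero    d = d
  turn^ (suc j) d = turn (turn^ j d)

  opposite : Direction → Direction
  opposite = turn^ 3

  ρ-unit : ∀ d → ρ (unit d) ≡ unit (turn d)
  ρ-unit d₀ = refl
  ρ-unit d₁ = refl
  ρ-unit d₂ = refl
  ρ-unit d₃ = refl
  ρ-unit d₄ = refl
  ρ-unit d₅ = refl

  ρ^-unit : ∀ j d → ρ^ j (unit d) ≡ unit (turn^ j d)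
  ρ^-unit zero    d = refl
  ρ^-unit (suc j) d = trans (cong ρ (ρ^-unit j d)) (ρ-unit (turn^ j d))

  unit-opposite : ∀ d → unit (opposite d) ≡ ⊖ unit d
  unit-opposite d = trans (sym (ρ^-unit 3 d)) (ρ³≡⊖ (unit d))

  angle : Direction → ℕ
  angle d₀ = 0
  angle d₁ = 1
  angle d₂ = 2
  angle d₃ = 3
  angle d₄ = 4
  angle d₅ = 5

  turn^-+ : ∀ i j d → turn^ (i ℕ.+ j) d ≡ turn^ i (turn^ j d)
  turn^-+ zero    j d = refl
  turn^-+ (suc i) j d = cong turn (turn^-+ i j d)

  turn^-to-d₀ : ∀ d → turn^ (6 ℕ.∸ angle d) d ≡ d₀
  turn^-to-d₀ d₀ = refl
  turn^-to-d₀ d₁ = refl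
  turn^-to-d₀ d₂ = refl
  turn^-to-d₀ d₃ = refl
  turn^-to-d₀ d₄ = refl
  turn^-to-d₀ d₅ = refl

  turn^-from-d₀ : ∀ d → turn^ (angle d) d₀ ≡ d
  turn^-from-d₀ d₀ = refl
  turn^-from-d₀ d₁ = refl
  turn^-from-d₀ d₂ = refl
  turn^-from-d₀ d₃ = refl
  turn^-from-d₀ d₄ = refl
  turn^-from-d₀ d₅ = refl

  turns-between : Direction → Direction → ℕ
  turns-between d d′ = angle d′ ℕ.+ (6 ℕ.∸ angle d)

  turn^-between : ∀ d d′ → turn^ (turns-between d d′) d ≡ d′
  turn^-between d d′ = trans (turn^-+ (angle d′) (6 ℕ.∸ angle d) d)
    (trans (cong (turn^ (angle d′)) (turn^-to-d₀ d)) (turn^-from-d₀ d′))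

  ⊕-swap : ∀ p q r → p ⊕ q ⊕ r ≡ p ⊕ r ⊕ q
  ⊕-swap (a , b) (a′ , b′) (a″ , b″) = cong₂ _,_ (swap a a′ a″) (swap b b′ b″)
    where
    swap : ∀ x y z → x + y + z ≡ x + z + y
    swap = solve-∀

  ⊕-⊖-cancelʳ : ∀ p q → p ⊕ q ⊕ ⊖ q ≡ p
  ⊕-⊖-cancelʳ (a , b) (a′ , b′) = cong₂ _,_ (cancel a a′) (cancel b b′)
    where
    cancel : ∀ x y → x + y + - y ≡ x
    cancel = solve-∀

  ⊖-⊕-cancelʳ : ∀ p q → p ⊕ ⊖ q ⊕ q ≡ p
  ⊖-⊕-cancelʳ (a , b) (a′ , b′) = cong₂ _,_ (cancel a a′) (cancel b b′)
    where
    cancel : ∀ x y → x + - y + y ≡ x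
    cancel = solve-∀

  ⊕-⊖-translate : ∀ p q → p ⊕ (q ⊕ ⊖ p) ≡ q
  ⊕-⊖-translate (a , b) (a′ , b′) = cong₂ _,_ (translate a a′) (translate b b′)
    where
    translate : ∀ x y → x + (y + - x) ≡ y
    translate = solve-∀

  affine : ℕ → Vec2 → Vec2 → Vec2
  affine j t p = ρ^ j p ⊕ t

  affine⁻¹ : ℕ → Vec2 → Vec2 → Vec2
  affine⁻¹ j t = affine (j ℕ.* 5) (⊖ ρ^ (j ℕ.* 5) t)

  affine⁻¹-affine : ∀ j t p → affine⁻¹ j t (affine j t p) ≡ p
  affine⁻¹-affine j t p = begin
    ρ^ j5 (ρ^ j p ⊕ t) ⊕ ⊖ ρ^ j5 t           ≡⟨ cong (_⊕ ⊖ ρ^ j5 t) (ρ^-⊕ j5 (ρ^ j p) t) ⟩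
    ρ^ j5 (ρ^ j p) ⊕ ρ^ j5 t ⊕ ⊖ ρ^ j5 t     ≡⟨ ⊕-⊖-cancelʳ (ρ^ j5 (ρ^ j p)) (ρ^ j5 t) ⟩
    ρ^ j5 (ρ^ j p)                           ≡⟨ ρ^-inverseˡ j p ⟩
    p                                        ∎
    where
    open ≡-Reasoning
    j5 = j ℕ.* 5

  affine-affine⁻¹ : ∀ j t p → affine j t (affine⁻¹ j t p) ≡ p
  affine-affine⁻¹ j t p = begin
    ρ^ j (ρ^ j5 p ⊕ ⊖ ρ^ j5 t) ⊕ t
      ≡⟨ cong (_⊕ t) (ρ^-⊕ j (ρ^ j5 p) (⊖ ρ^ j5 t)) ⟩
    ρ^ j (ρ^ j5 p) ⊕ ρ^ j (⊖ ρ^ j5 t) ⊕ t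
      ≡⟨ cong (λ u → ρ^ j (ρ^ j5 p) ⊕ u ⊕ t) (ρ^-⊖ j (ρ^ j5 t)) ⟩
    ρ^ j (ρ^ j5 p) ⊕ ⊖ ρ^ j (ρ^ j5 t) ⊕ t
      ≡⟨ cong₂ (λ u v → u ⊕ ⊖ v ⊕ t) (ρ^-inverseʳ j p) (ρ^-inverseʳ j t) ⟩
    p ⊕ ⊖ t ⊕ t
      ≡⟨ ⊖-⊕-cancelʳ p t ⟩
    p                                            ∎
    where
    open ≡-Reasoning
    j5 = j ℕ.* 5

  affine-unit : ∀ j t p d → affine j t (p ⊕ unit d) ≡ affine j t p ⊕ unit (turn^ j d)
  affine-unit j t p d = begin
    ρ^ j (p ⊕ unit d) ⊕ t            ≡⟨ cong (_⊕ t) (ρ^-⊕ j p (unit d)) ⟩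
    ρ^ j p ⊕ ρ^ j (unit d) ⊕ t       ≡⟨ cong (λ u → ρ^ j p ⊕ u ⊕ t) (ρ^-unit j d) ⟩
    ρ^ j p ⊕ unit (turn^ j d) ⊕ t    ≡⟨ ⊕-swap (ρ^ j p) (unit (turn^ j d)) t ⟩
    ρ^ j p ⊕ t ⊕ unit (turn^ j d)    ∎
    where open ≡-Reasoning

  arc-map : Direction → Direction → Vec2 → Vec2 → Vec2 → Vec2
  arc-map d d′ p p′ = affine (turns-between d d′) (p′ ⊕ ⊖ ρ^ (turns-between d d′) p)

  arc-map-source : ∀ d d′ p p′ → arc-map d d′ p p′ p ≡ p′
  arc-map-source d d′ p p′ = ⊕-⊖-translate (ρ^ (turns-between d d′) p) p′

  arc-map-target : ∀ d d′ p p′ → arc-map d d′ p p′ (p ⊕ unit d) ≡ p′ ⊕ unit d′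
  arc-map-target d d′ p p′ = begin
    arc-map d d′ p p′ (p ⊕ unit d)                ≡⟨ affine-unit j _ p d ⟩
    arc-map d d′ p p′ p ⊕ unit (turn^ j d)
      ≡⟨ cong₂ (λ u v → u ⊕ unit v) (arc-map-source d d′ p p′) (turn^-between d d′) ⟩
    p′ ⊕ unit d′                                  ∎
    where
    open ≡-Reasoning
    j = turns-between d d′

  module Quotient (L : Vec2 → Set)
    (L-𝟎 : L 𝟎)
    (L-⊕ : ∀ {p q} → L p → L q → L (p ⊕ q))
    (L-⊖ : ∀ {p} → L p → L (⊖ p))
    (L-ρ : ∀ {p} → L p → L (ρ p)) where

    infix 4 _~_
    record _~_ (p q : Vec2) : Set where
      constructor ~-intro
      field difference : L (p ⊕ ⊖ q)

    private
      L-resp : ∀ {p q} → p ≡ q → L p → L q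
      L-resp = subst L

    ~-refl : ∀ {p} → p ~ p
    ~-refl {a , b} = ~-intro (L-resp (cong₂ _,_ (sym (cancel a)) (sym (cancel b))) L-𝟎)
      where
      cancel : ∀ x → x + - x ≡ + 0
      cancel = solve-∀

    ~-reflexive : ∀ {p q} → p ≡ q → p ~ q
    ~-reflexive refl = ~-refl

    ~-sym : ∀ {p q} → p ~ q → q ~ p
    ~-sym {a , b} {a′ , b′} (~-intro l) = ~-intro (L-resp (cong₂ _,_ (negate a a′) (negate b b′)) (L-⊖ l))
      where
      negate : ∀ x y → - (x + - y) ≡ y + - x
      negate = solve-∀

    ~-trans : ∀ {p q r} → p ~ q → q ~ r → p ~ r
    ~-trans {a , b} {a′ , b′} {a″ , b″} (~-intro l) (~-intro l′) =
      ~-intro (L-resp (cong₂ _,_ (telescope a a′ a″) (telescope b b′ b″)) (L-⊕ l l′))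
      where
      telescope : ∀ x y z → (x + - y) + (y + - z) ≡ x + - z
      telescope = solve-∀

    ~-setoid : Setoid _ _
    ~-setoid = record
      { Carrier = Vec2 ; _≈_ = _~_
      ; isEquivalence = record { refl = ~-refl ; sym = ~-sym ; trans = ~-trans } }

    ⊕-cong : ∀ {p q p′ q′} → p ~ q → p′ ~ q′ → p ⊕ p′ ~ q ⊕ q′
    ⊕-cong {a , b} {c , d} {a′ , b′} {c′ , d′} (~-intro l) (~-intro l′) =
      ~-intro (L-resp (cong₂ _,_ (regroup a c a′ c′) (regroup b d b′ d′)) (L-⊕ l l′))
      where
      regroup : ∀ x y x′ y′ → (x + - y) + (x′ + - y′) ≡ (x + x′) + - (y + y′)
      regroup = solve-∀

    Step : Vec2 → Vec2 → Set
    Step p q = Σ Direction λ d → q ~ p ⊕ unit d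

    ⊕-congʳ : ∀ {p q} u → p ~ q → p ⊕ u ~ q ⊕ u
    ⊕-congʳ u eq = ⊕-cong eq (~-refl {u})

    ⊕-cancelˡ : ∀ p {u v} → p ⊕ u ~ p ⊕ v → u ~ v
    ⊕-cancelˡ (a , b) {c , d} {c′ , d′} (~-intro l) =
      ~-intro (L-resp (cong₂ _,_ (cancel a c c′) (cancel b d d′)) l)
      where
      cancel : ∀ x y y′ → (x + y) + - (x + y′) ≡ y + - y′
      cancel = solve-∀

    ρ-cong : ∀ {p q} → p ~ q → ρ p ~ ρ q
    ρ-cong {p} {q} (~-intro l) =
      ~-intro (L-resp (trans (ρ-⊕ p (⊖ q)) (cong (ρ p ⊕_) (ρ-⊖ q))) (L-ρ l))

    affine-cong : ∀ j t {p q} → p ~ q → affine j t p ~ affine j t q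
    affine-cong j t eq = ⊕-congʳ t (ρ^-cong j eq)
      where
      ρ^-cong : ∀ j {p q} → p ~ q → ρ^ j p ~ ρ^ j q
      ρ^-cong zero    eq = eq
      ρ^-cong (suc j) eq = ρ-cong (ρ^-cong j eq)

    module _ (odd∉L : ∀ {x y} → y %ℕ 2 ≡ 1 → ¬ L (x , y))
             (twice-d₀∉L : ¬ L (unit d₀ ⊕ unit d₀)) where

      L-ρ^ : ∀ j {p} → L p → L (ρ^ j p)
      L-ρ^ zero    l = l
      L-ρ^ (suc j) l = L-ρ (L-ρ^ j l)

      twice-unit∉L : ∀ d → ¬ L (unit d ⊕ unit d)
      twice-unit∉L d₀ = twice-d₀∉L
      twice-unit∉L d₁ = twice-d₀∉L ∘ L-ρ^ 5
      twice-unit∉L d₂ = twice-d₀∉L ∘ L-ρ^ 4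
      twice-unit∉L d₃ = twice-d₀∉L ∘ L-ρ^ 3
      twice-unit∉L d₄ = twice-d₀∉L ∘ L-ρ^ 2
      twice-unit∉L d₅ = twice-d₀∉L ∘ L-ρ^ 1

      d₁≁d₅ : ¬ unit d₁ ~ unit d₅
      d₁≁d₅ (~-intro l) = odd∉L refl (L-ρ l)

      -- In each case unit a - unit d₀ - unit b ∈ L is 0, has an odd coordinate (the first
      -- coordinate is the second one of its ρ-image), or is twice a unit vector.
      common-neighbours : ∀ a b → unit a ~ unit d₀ ⊕ unit b → a ≡ d₁ ⊎ a ≡ d₅
      common-neighbours d₀ d₀ (~-intro l) = ⊥-elim (odd∉L refl (L-ρ l))
      common-neighbours d₀ d₁ (~-intro l) = ⊥-elim (odd∉L refl l)
      common-neighbours d₀ d₂ (~-intro l) = ⊥-elim (odd∉L refl l)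
      common-neighbours d₀ d₃ (~-intro l) = ⊥-elim (odd∉L refl (L-ρ l))
      common-neighbours d₀ d₄ (~-intro l) = ⊥-elim (odd∉L refl l)
      common-neighbours d₀ d₅ (~-intro l) = ⊥-elim (odd∉L refl l)
      common-neighbours d₁ d₀ (~-intro l) = ⊥-elim (odd∉L refl l)
      common-neighbours d₁ d₁ (~-intro l) = ⊥-elim (odd∉L refl (L-ρ l))
      common-neighbours d₁ d₂ _ = inj₁ refl
      common-neighbours d₁ d₃ (~-intro l) = ⊥-elim (odd∉L refl l)
      common-neighbours d₁ d₄ (~-intro l) = ⊥-elim (odd∉L refl (L-ρ l))
      common-neighbours d₁ d₅ (~-intro l) = ⊥-elim (twice-unit∉L d₂ l)
      common-neighbours d₂ d₀ (~-intro l) = ⊥-elim (odd∉L refl l)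
      common-neighbours d₂ d₁ (~-intro l) = ⊥-elim (twice-unit∉L d₃ l)
      common-neighbours d₂ d₂ (~-intro l) = ⊥-elim (odd∉L refl (L-ρ l))
      common-neighbours d₂ d₃ (~-intro l) = ⊥-elim (odd∉L refl l)
      common-neighbours d₂ d₄ (~-intro l) = ⊥-elim (twice-unit∉L d₂ l)
      common-neighbours d₂ d₅ (~-intro l) = ⊥-elim (odd∉L refl (L-ρ l))
      common-neighbours d₃ d₀ (~-intro l) = ⊥-elim (odd∉L refl (L-ρ l))
      common-neighbours d₃ d₁ (~-intro l) = ⊥-elim (odd∉L refl l)
      common-neighbours d₃ d₂ (~-intro l) = ⊥-elim (odd∉L refl l)
      common-neighbours d₃ d₃ (~-intro l) = ⊥-elim (odd∉L refl (L-ρ l))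
      common-neighbours d₃ d₄ (~-intro l) = ⊥-elim (odd∉L refl l)
      common-neighbours d₃ d₅ (~-intro l) = ⊥-elim (odd∉L refl l)
      common-neighbours d₄ d₀ (~-intro l) = ⊥-elim (odd∉L refl l)
      common-neighbours d₄ d₁ (~-intro l) = ⊥-elim (odd∉L refl (L-ρ l))
      common-neighbours d₄ d₂ (~-intro l) = ⊥-elim (twice-unit∉L d₄ l)
      common-neighbours d₄ d₃ (~-intro l) = ⊥-elim (odd∉L refl l)
      common-neighbours d₄ d₄ (~-intro l) = ⊥-elim (odd∉L refl (L-ρ l))
      common-neighbours d₄ d₅ (~-intro l) = ⊥-elim (twice-unit∉L d₃ l)
      common-neighbours d₅ d₀ (~-intro l) = ⊥-elim (odd∉L refl l)
      common-neighbours d₅ d₁ (~-intro l) = ⊥-elim (twice-unit∉L d₄ l)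
      common-neighbours d₅ d₂ (~-intro l) = ⊥-elim (odd∉L refl (L-ρ l))
      common-neighbours d₅ d₃ (~-intro l) = ⊥-elim (odd∉L refl l)
      common-neighbours d₅ d₄ _ = inj₂ refl
      common-neighbours d₅ d₅ (~-intro l) = ⊥-elim (odd∉L refl (L-ρ l))

  toℕ-shift : ∀ {n} .{{_ : NonZero n}} (i : Fin n) d → toℕ (shift i d) ≡ (toℕ i ℕ.+ d) % n
  toℕ-shift {suc n} i d = toℕ-fromℕ< _

  module NestLattice (m n : ℕ) (2∣n : 2 ∣ n) (n∣2[m²+m+1] : n ∣ 2 ℕ.* (m ℕ.* m ℕ.+ m ℕ.+ 1))
    (2<n : 2 ℕ.< n) where

    private instance
      n≢0 : NonZero n
      n≢0 = ℕ.>-nonZero (ℕP.<-trans (s≤s z≤n) 2<n)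

    M N Q R C : ℤ
    M = + m
    N = + n
    Q = + quotient 2∣n
    R = + quotient n∣2[m²+m+1]
    C = + 2 * (M + + 1)

    N≡Q*2 : N ≡ Q * + 2
    N≡Q*2 = trans (cong +_ (m∣n⇒n≡quotient*m 2∣n)) (pos-* (quotient 2∣n) 2)

    2[M²+M+1]≡R*N : + 2 * (M * M + M + + 1) ≡ R * N
    2[M²+M+1]≡R*N = begin
      + 2 * (M * M + M + + 1)          ≡⟨ cong (λ x → + 2 * (x + M + + 1)) (pos-* m m) ⟨
      + 2 * (+ (m ℕ.* m) + M + + 1)    ≡⟨ cong (λ x → + 2 * (x + + 1)) (pos-+ (m ℕ.* m) m) ⟨
      + 2 * (+ (m ℕ.* m ℕ.+ m) + + 1)  ≡⟨ cong (+ 2 *_) (pos-+ (m ℕ.* m ℕ.+ m) 1) ⟨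
      + 2 * + (m ℕ.* m ℕ.+ m ℕ.+ 1)    ≡⟨ pos-* 2 (m ℕ.* m ℕ.+ m ℕ.+ 1) ⟨
      + (2 ℕ.* (m ℕ.* m ℕ.+ m ℕ.+ 1))  ≡⟨ cong +_ (m∣n⇒n≡quotient*m n∣2[m²+m+1]) ⟩
      + (quotient n∣2[m²+m+1] ℕ.* n)   ≡⟨ pos-* (quotient n∣2[m²+m+1]) n ⟩
      R * N                            ∎
      where open ≡-Reasoning

    data L : Vec2 → Set where
      combination : ∀ t k → L (t * C + k * N , t * + 2)

    L-view : ∀ {a b} → L (a , b) → ∃₂ λ t k → a ≡ t * C + k * N × b ≡ t * + 2
    L-view (combination t k) = t , k , refl , refl

    L-𝟎 : L 𝟎
    L-𝟎 = combination (+ 0) (+ 0)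

    L-⊕ : ∀ {p q} → L p → L q → L (p ⊕ q)
    L-⊕ (combination t k) (combination t′ k′) =
      subst L (cong₂ _,_ (first t k t′ k′ C N) (second t t′)) (combination (t + t′) (k + k′))
      where
      first : ∀ t k t′ k′ C N → (t + t′) * C + (k + k′) * N ≡ (t * C + k * N) + (t′ * C + k′ * N)
      first = solve-∀
      second : ∀ t t′ → (t + t′) * + 2 ≡ t * + 2 + t′ * + 2
      second = solve-∀

    L-⊖ : ∀ {p} → L p → L (⊖ p)
    L-⊖ (combination t k) = subst L (cong₂ _,_ (negate t k C N) (negate₂ t)) (combination (- t) (- k))
      where
      negate : ∀ t k C N → (- t) * C + (- k) * N ≡ - (t * C + k * N)
      negate = solve-∀
      negate₂ : ∀ t → (- t) * + 2 ≡ - (t * + 2)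
      negate₂ = solve-∀

    -- The only use of n = 2 Q and 2 (m² + m + 1) = R n: they are what makes the rotation
    -- of t (C , 2) + k (n , 0) again an integral combination of the two generators.
    L-ρ : ∀ {p} → L p → L (ρ p)
    L-ρ (combination t k) = subst L (cong₂ _,_ first second) (combination t′ k′)
      where
      open ≡-Reasoning
      t′ = t * (M + + 1) + k * Q
      k′ = - (t * R) - k * M
      first-modulo-relations : ∀ t k M Q R N → (t * (M + + 1) + k * Q) * (+ 2 * (M + + 1)) + (- (t * R) - k * M) * N
        ≡ ((t * (+ 2 * (M + + 1)) + k * N) - t * + 2)
          + t * (+ 2 * (M * M + M + + 1) - R * N) + k * (M + + 1) * (Q * + 2 - N)
      first-modulo-relations = solve-∀
      second-modulo-relation : ∀ t k M Q N →
        (t * (M + + 1) + k * Q) * + 2 ≡ t * (+ 2 * (M + + 1)) + k * N + k * (Q * + 2 - N)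
      second-modulo-relation = solve-∀
      drop-zeros : ∀ x s s′ → x + s * (+ 0) + s′ * (+ 0) ≡ x
      drop-zeros = solve-∀
      drop-zero : ∀ x s → x + s * (+ 0) ≡ x
      drop-zero = solve-∀
      first : t′ * C + k′ * N ≡ (t * C + k * N) - t * + 2
      first = begin
        t′ * C + k′ * N
          ≡⟨ first-modulo-relations t k M Q R N ⟩
        ((t * C + k * N) - t * + 2) + t * (+ 2 * (M * M + M + + 1) - R * N) + k * (M + + 1) * (Q * + 2 - N)
          ≡⟨ cong₂ (λ u v → ((t * C + k * N) - t * + 2) + t * u + k * (M + + 1) * v)
                   (i≡j⇒i-j≡0 2[M²+M+1]≡R*N) (i≡j⇒i-j≡0 (sym N≡Q*2)) ⟩
        ((t * C + k * N) - t * + 2) + t * + 0 + k * (M + + 1) * + 0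
          ≡⟨ drop-zeros _ t (k * (M + + 1)) ⟩
        (t * C + k * N) - t * + 2 ∎
      second : t′ * + 2 ≡ t * C + k * N
      second = begin
        t′ * + 2                                   ≡⟨ second-modulo-relation t k M Q N ⟩
        t * C + k * N + k * (Q * + 2 - N)          ≡⟨ cong (λ v → t * C + k * N + k * v) (i≡j⇒i-j≡0 (sym N≡Q*2)) ⟩
        t * C + k * N + k * + 0                    ≡⟨ drop-zero _ k ⟩
        t * C + k * N                              ∎

    odd∉L : ∀ {x y} → y %ℕ 2 ≡ 1 → ¬ L (x , y)
    odd∉L {y = y} odd l with L-view l
    ... | t , _ , _ , y≡2t =
      ℕP.1+n≢0 (trans (sym odd) (%ℕ-cong 2 (+ 0) t (trans y≡2t (sym (+-identityˡ (t * + 2))))))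

    twice-d₀∉L : ¬ L (unit d₀ ⊕ unit d₀)
    twice-d₀∉L l with L-view l
    ... | t , k , 2≡tC+kN , 0≡2t with *-cancelʳ-≡ t (+ 0) (+ 2) (sym 0≡2t)
    ... | refl with multiple-of-<-is-zero n {k} (trans 2≡tC+kN (+-identityˡ (k * N))) 2<n
    ... | ()

    open Quotient L L-𝟎 L-⊕ L-⊖ L-ρ

    level : Side → ℤ
    level U = + 0
    level V = + 1

    enc : Vertex n → Vec2
    enc (s , i) = + toℕ i , level s

    side : ℕ → Side
    side zero    = U
    side (suc _) = V

    -- dec slides (a , b) along the generator (C , 2) of L to the row 0 or 1 of the same parity,
    -- then reduces the first coordinate modulo n.
    column : Side → Vec2 → ℤ
    column s (a , b) = a - (b - level s) * (M + + 1)

    dec : Vec2 → Vertex n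
    dec (a , b) = s , fromℕ< (n%ℕd<d (column s (a , b)) n)
      where s = side (b %ℕ 2)

    row-offset : ∀ b → b - level (side (b %ℕ 2)) ≡ (b /ℕ 2) * + 2
    row-offset b = by-remainder (b %ℕ 2) (n%ℕd<d b 2) (a≡a%ℕn+[a/ℕn]*n b 2)
      where
      cancel : ∀ r q → (r + q) - r ≡ q
      cancel = solve-∀
      by-remainder : ∀ r → r ℕ.< 2 → b ≡ + r + (b /ℕ 2) * + 2 → b - level (side r) ≡ (b /ℕ 2) * + 2
      by-remainder 0 _ eq = trans (cong (_- + 0) eq) (cancel (+ 0) _)
      by-remainder 1 _ eq = trans (cong (_- + 1) eq) (cancel (+ 1) _)
      by-remainder (suc (suc _)) (s≤s (s≤s ())) _

    enc-dec : ∀ p → enc (dec p) ~ p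
    enc-dec (a , b) = ~-intro (subst L (cong₂ _,_ first second) (combination (- t) (- q)))
      where
      open ≡-Reasoning
      s = side (b %ℕ 2)
      t = b /ℕ 2
      q = column s (a , b) /ℕ n
      r = column s (a , b) %ℕ n
      regroup : ∀ a t q M N → (- t) * (+ 2 * (M + + 1)) + (- q) * N ≡ (a - (t * + 2) * (M + + 1) - q * N) - a
      regroup = solve-∀
      cancel : ∀ r x a → (r + x - x) - a ≡ r - a
      cancel = solve-∀
      negate : ∀ t → (- t) * + 2 ≡ - (t * + 2)
      negate = solve-∀
      flip : ∀ x y → - (x - y) ≡ y - x
      flip = solve-∀
      first : (- t) * C + (- q) * N ≡ + toℕ (proj₂ (dec (a , b))) - a
      first = begin
        (- t) * C + (- q) * N                         ≡⟨ regroup a t q M N ⟩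
        (a - (t * + 2) * (M + + 1) - q * N) - a
          ≡⟨ cong (λ e → (a - e * (M + + 1) - q * N) - a) (row-offset b) ⟨
        (column s (a , b) - q * N) - a
          ≡⟨ cong (λ x → (x - q * N) - a) (a≡a%ℕn+[a/ℕn]*n (column s (a , b)) n) ⟩
        (+ r + q * N - q * N) - a                     ≡⟨ cancel (+ r) (q * N) a ⟩
        + r - a                                       ≡⟨ cong (λ i → + i - a) (toℕ-fromℕ< _) ⟨
        + toℕ (proj₂ (dec (a , b))) - a               ∎
      second : (- t) * + 2 ≡ level s - b
      second = begin
        (- t) * + 2        ≡⟨ negate t ⟩
        - (t * + 2)        ≡⟨ cong -_ (row-offset b) ⟨
        - (b - level s)    ≡⟨ flip b (level s) ⟩
        level s - b        ∎

    dec-cong : ∀ {p q} → p ~ q → dec p ≡ dec q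
    dec-cong {a , b} {a′ , b′} (~-intro l) with L-view l
    ... | t , k , a-a′≡tC+kN , b-b′≡2t =
      cong₂ _,_ (cong side same-parity) (fromℕ<-cong _ _ same-column _ _)
      where
      open ≡-Reasoning
      split : ∀ x x′ → x ≡ x′ + (x - x′)
      split = solve-∀
      slide : ∀ a′ b′ l t k M N → (a′ + (t * (+ 2 * (M + + 1)) + k * N)) - ((b′ + t * + 2) - l) * (M + + 1)
                                 ≡ (a′ - (b′ - l) * (M + + 1)) + k * N
      slide = solve-∀
      same-parity : b %ℕ 2 ≡ b′ %ℕ 2
      same-parity = %ℕ-cong 2 b′ t (trans (split b b′) (cong (λ x → b′ + x) b-b′≡2t))
      column-shift : ∀ s → column s (a , b) ≡ column s (a′ , b′) + k * N
      column-shift s = begin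
        a - (b - level s) * (M + + 1)
          ≡⟨ cong₂ (λ x y → x - (y - level s) * (M + + 1)) (split a a′) (split b b′) ⟩
        (a′ + (a - a′)) - ((b′ + (b - b′)) - level s) * (M + + 1)
          ≡⟨ cong₂ (λ x y → (a′ + x) - ((b′ + y) - level s) * (M + + 1)) a-a′≡tC+kN b-b′≡2t ⟩
        (a′ + (t * C + k * N)) - ((b′ + t * + 2) - level s) * (M + + 1)
          ≡⟨ slide a′ b′ (level s) t k M N ⟩
        column s (a′ , b′) + k * N ∎
      same-column : column (side (b %ℕ 2)) (a , b) %ℕ n ≡ column (side (b′ %ℕ 2)) (a′ , b′) %ℕ n
      same-column = trans (%ℕ-cong n (column (side (b %ℕ 2)) (a′ , b′)) k (column-shift (side (b %ℕ 2))))
                          (cong (λ s → column (side s) (a′ , b′) %ℕ n) same-parity)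

    index-of-enc : ∀ s i → fromℕ< (n%ℕd<d (column s (enc (s , i))) n) ≡ i
    index-of-enc s i = toℕ-injective (begin
      toℕ (fromℕ< _)                     ≡⟨ toℕ-fromℕ< _ ⟩
      column s (enc (s , i)) %ℕ n        ≡⟨ cong (_%ℕ n) (same-row (+ toℕ i) (level s) M) ⟩
      toℕ i % n                          ≡⟨ m<n⇒m%n≡m (toℕ<n i) ⟩
      toℕ i                              ∎)
      where
      open ≡-Reasoning
      same-row : ∀ a l M → a - (l - l) * (M + + 1) ≡ a
      same-row = solve-∀

    dec-enc : ∀ x → dec (enc x) ≡ x
    dec-enc (U , i) = cong (U ,_) (index-of-enc U i)
    dec-enc (V , i) = cong (V ,_) (index-of-enc V i)

    enc-injective : ∀ {x y} → enc x ~ enc y → x ≡ y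
    enc-injective {x} {y} x~y = trans (sym (dec-enc x)) (trans (dec-cong x~y) (dec-enc y))

    shift-~ : ∀ s i d → enc (s , shift i d) ~ enc (s , i) ⊕ (+ d , + 0)
    shift-~ s i d = ~-intro (subst L (cong₂ _,_ first (second (level s))) (combination (+ 0) (- + (x / n))))
      where
      open ≡-Reasoning
      x = toℕ i ℕ.+ d
      reduce : ∀ r q C N → + 0 * C + (- q) * N ≡ r - (r + q * N)
      reduce = solve-∀
      second : ∀ l → + 0 * + 2 ≡ l - (l + + 0)
      second = solve-∀
      first : + 0 * C + (- + (x / n)) * N ≡ + toℕ (shift i d) - (+ toℕ i + + d)
      first = begin
        + 0 * C + (- + (x / n)) * N            ≡⟨ reduce (+ (x % n)) (+ (x / n)) C N ⟩
        + (x % n) - (+ (x % n) + + (x / n) * N) ≡⟨ cong (λ y → + (x % n) - (+ (x % n) + y)) (pos-* (x / n) n) ⟨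
        + (x % n) - (+ (x % n) + + (x / n ℕ.* n)) ≡⟨ cong (λ y → + (x % n) - y) (pos-+ (x % n) (x / n ℕ.* n)) ⟨
        + (x % n) - + (x % n ℕ.+ x / n ℕ.* n)   ≡⟨ cong (λ y → + (x % n) - + y) (m≡m%n+[m/n]*n x n) ⟨
        + (x % n) - + x                         ≡⟨ cong₂ (λ y z → + y - z) (toℕ-shift i d) (pos-+ (toℕ i) d) ⟨
        + toℕ (shift i d) - (+ toℕ i + + d)      ∎

    g : Vec2
    g = C , + 2

    ⊕-g : ∀ p → p ⊕ g ~ p
    ⊕-g (a , b) = ~-intro (subst L (cong₂ _,_ (first a C N) (second b)) (combination (+ 1) (+ 0)))
      where
      first : ∀ a C N → + 1 * C + + 0 * N ≡ (a + C) - a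
      first = solve-∀
      second : ∀ b → + 1 * + 2 ≡ (b + + 2) - b
      second = solve-∀

    absorb-g : ∀ {q} p u → q ~ p ⊕ (u ⊕ g) → q ~ p ⊕ u
    absorb-g {q} p u q~p+u+g = begin
      q             ≈⟨ q~p+u+g ⟩
      p ⊕ (u ⊕ g)   ≡⟨ ⊕-assoc p u g ⟨
      p ⊕ u ⊕ g     ≈⟨ ⊕-g (p ⊕ u) ⟩
      p ⊕ u         ∎
      where open SetoidReasoning ~-setoid

    b c : ℕ
    b = 2 ℕ.* m ℕ.+ 1
    c = 2 ℕ.* m ℕ.+ 2

    b≡d₄+g : (+ b , + 1) ≡ unit d₄ ⊕ g
    b≡d₄+g = cong (_, + 1) (trans (pos-+ (2 ℕ.* m) 1) (trans (cong (_+ + 1) (pos-* 2 m)) (shift-by M)))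
      where
      shift-by : ∀ M → + 2 * M + + 1 ≡ -[1+ 0 ] + + 2 * (M + + 1)
      shift-by = solve-∀

    c≡d₅+g : (+ c , + 1) ≡ unit d₅ ⊕ g
    c≡d₅+g = cong (_, + 1) (trans (pos-+ (2 ℕ.* m) 2) (trans (cong (_+ + 2) (pos-* 2 m)) (shift-by M)))
      where
      shift-by : ∀ M → + 2 * M + + 2 ≡ + 0 + + 2 * (M + + 1)
      shift-by = solve-∀

    long-edge : ∀ i e u → (+ e , + 1) ≡ u ⊕ g → enc (V , shift i e) ~ enc (U , i) ⊕ u
    long-edge i e u e≡u+g =
      absorb-g (enc (U , i)) u (subst (λ w → enc (V , shift i e) ~ enc (U , i) ⊕ w) e≡u+g (shift-~ V i e))

    Edge Adj : Vertex n → Vertex n → Set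
    Edge = NestEdge n 1 b c 1
    Adj = NestAdj n 1 b c 1

    edge-step : ∀ {x y} → Edge x y → Step (enc x) (enc y)
    edge-step (uu i)  = d₀ , shift-~ U i 1
    edge-step (vv i)  = d₀ , shift-~ V i 1
    edge-step (uv0 i) = d₂ , ~-reflexive (cong (_, + 1) (sym (+-identityʳ (+ toℕ i))))
    edge-step (uva i) = d₁ , shift-~ V i 1
    edge-step (uvb i) = d₄ , long-edge i b (unit d₄) b≡d₄+g
    edge-step (uvc i) = d₅ , long-edge i c (unit d₅) c≡d₅+g

    adj-step : ∀ {x y} → Adj x y → Step (enc x) (enc y)
    adj-step (inj₁ e) = edge-step e
    adj-step {x} {y} (inj₂ e) with edge-step e
    ... | d , x~y+d = opposite d , (begin
      enc y                         ≡⟨ ⊕-⊖-cancelʳ (enc y) (unit d) ⟨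
      enc y ⊕ unit d ⊕ ⊖ unit d     ≈⟨ ⊕-congʳ (⊖ unit d) (~-sym x~y+d) ⟩
      enc x ⊕ ⊖ unit d              ≡⟨ cong (enc x ⊕_) (unit-opposite d) ⟨
      enc x ⊕ unit (opposite d)     ∎)
      where open SetoidReasoning ~-setoid

    Neighbour : Vertex n → Direction → Set
    Neighbour x d = Σ (Vertex n) λ y → Adj x y × enc y ~ enc x ⊕ unit d

    outgoing : ∀ {x y} (e : Edge x y) → Neighbour x (proj₁ (edge-step e))
    outgoing {y = y} e = y , inj₁ e , proj₂ (edge-step e)

    incoming : ∀ {x} d {w} → let y = dec (enc x ⊕ unit d) in
               Edge y w → enc w ~ enc y ⊕ unit (opposite d) → Neighbour x d
    incoming {x} d {w} e w~y-d = y , inj₂ (subst (Edge y) (enc-injective w~x) e) , enc-dec (enc x ⊕ unit d)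
      where
      open SetoidReasoning ~-setoid
      y = dec (enc x ⊕ unit d)
      w~x : enc w ~ enc x
      w~x = begin
        enc w                              ≈⟨ w~y-d ⟩
        enc y ⊕ unit (opposite d)          ≈⟨ ⊕-congʳ (unit (opposite d)) (enc-dec (enc x ⊕ unit d)) ⟩
        enc x ⊕ unit d ⊕ unit (opposite d) ≡⟨ cong (enc x ⊕ unit d ⊕_) (unit-opposite d) ⟩
        enc x ⊕ unit d ⊕ ⊖ unit d          ≡⟨ ⊕-⊖-cancelʳ (enc x) (unit d) ⟩
        enc x                              ∎

    neighbour : ∀ x d → Neighbour x d
    neighbour (U , i) d₀ = outgoing (uu i)
    neighbour (U , i) d₁ = outgoing (uva i)
    neighbour (U , i) d₂ = outgoing (uv0 i)
    neighbour (U , i) d₃ = incoming d₃ (uu _) (proj₂ (edge-step (uu _)))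
    neighbour (U , i) d₄ = outgoing (uvb i)
    neighbour (U , i) d₅ = outgoing (uvc i)
    neighbour (V , i) d₀ = outgoing (vv i)
    neighbour (V , i) d₁ = incoming d₁ (uvb _) (proj₂ (edge-step (uvb _)))
    neighbour (V , i) d₂ = incoming d₂ (uvc _) (proj₂ (edge-step (uvc _)))
    neighbour (V , i) d₃ = incoming d₃ (vv _) (proj₂ (edge-step (vv _)))
    neighbour (V , i) d₄ = incoming d₄ (uva _) (proj₂ (edge-step (uva _)))
    neighbour (V , i) d₅ = incoming d₅ (uv0 _) (proj₂ (edge-step (uv0 _)))

    step-adj : ∀ {x y} → Step (enc x) (enc y) → Adj x y
    step-adj {x} (d , y~x+d) with neighbour x d
    ... | y′ , x~y′ , y′~x+d = subst (Adj x) (enc-injective (~-trans y′~x+d (~-sym y~x+d))) x~y′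

    induced : (Vec2 → Vec2) → Vertex n → Vertex n
    induced f x = dec (f (enc x))

    enc-induced : ∀ f x → enc (induced f x) ~ f (enc x)
    enc-induced f x = enc-dec (f (enc x))

    induced-inverse : ∀ f f⁻¹ → (∀ {p q} → p ~ q → f⁻¹ p ~ f⁻¹ q) → (∀ p → f⁻¹ (f p) ≡ p) →
                      ∀ x → induced f⁻¹ (induced f x) ≡ x
    induced-inverse f f⁻¹ f⁻¹-cong f⁻¹∘f≡id x = enc-injective (begin
      enc (induced f⁻¹ (induced f x)) ≈⟨ enc-induced f⁻¹ (induced f x) ⟩
      f⁻¹ (enc (induced f x))         ≈⟨ f⁻¹-cong (enc-induced f x) ⟩
      f⁻¹ (f (enc x))                 ≡⟨ f⁻¹∘f≡id (enc x) ⟩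
      enc x                           ∎)
      where open SetoidReasoning ~-setoid

    affine-adj : ∀ j t {x y} → Adj x y → Adj (induced (affine j t) x) (induced (affine j t) y)
    affine-adj j t {x} {y} x~y with adj-step x~y
    ... | d , y~x+d = step-adj (turn^ j d , (begin
      enc (induced (affine j t) y)               ≈⟨ enc-induced (affine j t) y ⟩
      affine j t (enc y)                         ≈⟨ affine-cong j t y~x+d ⟩
      affine j t (enc x ⊕ unit d)                ≡⟨ affine-unit j t (enc x) d ⟩
      affine j t (enc x) ⊕ unit (turn^ j d)      ≈⟨ ⊕-congʳ (unit (turn^ j d)) (enc-induced (affine j t) x) ⟨
      enc (induced (affine j t) x) ⊕ unit (turn^ j d) ∎))
      where open SetoidReasoning ~-setoid

    affine-automorphism : ℕ → Vec2 → Automorphism Adj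
    affine-automorphism j t = record
      { bij = mk↔ₛ′ (induced (affine j t)) (induced (affine⁻¹ j t))
                    (induced-inverse (affine⁻¹ j t) (affine j t) (affine-cong j t) (affine-affine⁻¹ j t))
                    (induced-inverse (affine j t) (affine⁻¹ j t) (affine-cong (j ℕ.* 5) _) (affine⁻¹-affine j t))
      ; preserve = λ x y → mk⇔ (affine-adj j t)
          (λ fx~fy → subst₂ Adj (inverse x) (inverse y) (affine-adj (j ℕ.* 5) (⊖ ρ^ (j ℕ.* 5) t) fx~fy))
      }
      where
      inverse : ∀ x → induced (affine⁻¹ j t) (induced (affine j t) x) ≡ x
      inverse = induced-inverse (affine j t) (affine⁻¹ j t) (affine-cong (j ℕ.* 5) _) (affine⁻¹-affine j t)

    arc-transitive : ArcTransitive Adj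
    arc-transitive x y x′ y′ x~y x′~y′ with adj-step x~y | adj-step x′~y′
    ... | d , y~x+d | d′ , y′~x′+d′ =
      affine-automorphism j t , enc-injective source , enc-injective target
      where
      open SetoidReasoning ~-setoid
      j = turns-between d d′
      t = enc x′ ⊕ ⊖ ρ^ j (enc x)
      source : enc (induced (affine j t) x) ~ enc x′
      source = begin
        enc (induced (affine j t) x)   ≈⟨ enc-induced (affine j t) x ⟩
        arc-map d d′ (enc x) (enc x′) (enc x) ≡⟨ arc-map-source d d′ (enc x) (enc x′) ⟩
        enc x′                         ∎
      target : enc (induced (affine j t) y) ~ enc y′
      target = begin
        enc (induced (affine j t) y)   ≈⟨ enc-induced (affine j t) y ⟩
        affine j t (enc y)             ≈⟨ affine-cong j t y~x+d ⟩
        arc-map d d′ (enc x) (enc x′) (enc x ⊕ unit d) ≡⟨ arc-map-target d d′ (enc x) (enc x′) ⟩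
        enc x′ ⊕ unit d′               ≈⟨ y′~x′+d′ ⟨
        enc y′                         ∎

    triangles-along-d₀ : ∀ {x y} → enc y ~ enc x ⊕ unit d₀ → OnExactlyTwoTriangles Adj x y
    triangles-along-d₀ {x} {y} y~x+d₀ =
      z₁ , z₂ , z₁≢z₂ ,
      (step-adj (d₁ , enc-dec (enc x ⊕ unit d₁)) , step-adj (d₂ , via-y d₁ d₂ refl)) ,
      (step-adj (d₅ , enc-dec (enc x ⊕ unit d₅)) , step-adj (d₄ , via-y d₅ d₄ refl)) ,
      only
      where
      open SetoidReasoning ~-setoid
      z₁ z₂ : Vertex n
      z₁ = dec (enc x ⊕ unit d₁)
      z₂ = dec (enc x ⊕ unit d₅)
      via-y : ∀ e f → unit e ≡ unit d₀ ⊕ unit f → enc (dec (enc x ⊕ unit e)) ~ enc y ⊕ unit f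
      via-y e f e≡d₀+f = begin
        enc (dec (enc x ⊕ unit e))  ≈⟨ enc-dec (enc x ⊕ unit e) ⟩
        enc x ⊕ unit e              ≡⟨ cong (enc x ⊕_) e≡d₀+f ⟩
        enc x ⊕ (unit d₀ ⊕ unit f)  ≡⟨ ⊕-assoc (enc x) (unit d₀) (unit f) ⟨
        enc x ⊕ unit d₀ ⊕ unit f    ≈⟨ ⊕-congʳ (unit f) y~x+d₀ ⟨
        enc y ⊕ unit f              ∎
      z₁≢z₂ : ¬ z₁ ≡ z₂
      z₁≢z₂ z₁≡z₂ = d₁≁d₅ odd∉L twice-d₀∉L (⊕-cancelˡ (enc x) (begin
        enc x ⊕ unit d₁   ≈⟨ enc-dec (enc x ⊕ unit d₁) ⟨
        enc z₁            ≡⟨ cong enc z₁≡z₂ ⟩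
        enc z₂            ≈⟨ enc-dec (enc x ⊕ unit d₅) ⟩
        enc x ⊕ unit d₅   ∎))
      only : ∀ z → ClosesTriangle Adj x y z → z ≡ z₁ ⊎ z ≡ z₂
      only z (x~z , y~z) with adj-step x~z | adj-step y~z
      ... | a , z~x+a | b′ , z~y+b
        with common-neighbours odd∉L twice-d₀∉L a b′ (⊕-cancelˡ (enc x) (begin
          enc x ⊕ unit a              ≈⟨ z~x+a ⟨
          enc z                       ≈⟨ z~y+b ⟩
          enc y ⊕ unit b′             ≈⟨ ⊕-congʳ (unit b′) y~x+d₀ ⟩
          enc x ⊕ unit d₀ ⊕ unit b′   ≡⟨ ⊕-assoc (enc x) (unit d₀) (unit b′) ⟩
          enc x ⊕ (unit d₀ ⊕ unit b′) ∎))
      ... | inj₁ refl = inj₁ (enc-injective (~-trans z~x+a (~-sym (enc-dec (enc x ⊕ unit d₁)))))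
      ... | inj₂ refl = inj₂ (enc-injective (~-trans z~x+a (~-sym (enc-dec (enc x ⊕ unit d₅)))))

    every-edge-on-two-triangles : EveryEdgeOnExactlyTwoTriangles Adj
    every-edge-on-two-triangles =
      arc-transitive-triangles Adj arc-transitive (step-adj {x₀} {y₀} (d₀ , y₀~x₀+d₀))
        (triangles-along-d₀ {x₀} {y₀} y₀~x₀+d₀)
      where
      x₀ y₀ : Vertex n
      x₀ = dec 𝟎
      y₀ = dec (enc x₀ ⊕ unit d₀)
      y₀~x₀+d₀ : enc y₀ ~ enc x₀ ⊕ unit d₀
      y₀~x₀+d₀ = enc-dec (enc x₀ ⊕ unit d₀)

open import Data.Nat using (_+_; _*_; _≤_)
open TriangularLattice using (module NestLattice)

lemma4p5 : ∀ (m n : ℕ) → 1 ≤ m → 2 ∣ n → n ∣ 2 * (m * m + m + 1) → 4 * m + 2 ≤ n →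
    ArcTransitive (NestAdj n 1 (2 * m + 1) (2 * m + 2) 1)
      × EveryEdgeOnExactlyTwoTriangles (NestAdj n 1 (2 * m + 1) (2 * m + 2) 1)
lemma4p5 m n 1≤m 2∣n n∣2[m²+m+1] 4m+2≤n = arc-transitive , every-edge-on-two-triangles
  where
  -- 1 ≤ m and 4 m + 2 ≤ n are only needed for n > 2.
  2<n : 2 ℕ.< n
  2<n = ℕP.<-≤-trans (ℕP.+-monoˡ-< 2 (ℕP.<-≤-trans (s≤s z≤n) (ℕP.*-monoʳ-≤ 4 1≤m))) 4m+2≤n
  open NestLattice m n 2∣n n∣2[m²+m+1] 2<n
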